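{- Let $n \ge 1$. Among all trees on $n$ vertices, the star $S_n = K_{1,n-1}$ has the maximum weighted Szeged index; that is, for every tree $T$ on $n$ vertices, $wSz(T) \le wSz(S_n)$.
   Context: For a connected simple graph $G$ and an edge $e = uv \in E(G)$, let $n_u(e)$ denote the number of vertices $x \in V(G)$ with $d(x,u) < d(x,v)$, where $d$ is the shortest-path distance in $G$ (and similarly $n_v(e)$). The weighted Szeged index of $G$ is $$wSz(G) = \sum_{e = uv \in E(G)} \big(\deg(u) + \deg(v)\big)\, n_u(e)\, n_v(e),$$ where $\deg(u)$ is the degree of $u$. The star $S_n$ is the complete bipartite graph $K_{1,n-1}$. -}

module Defs where

open import Data.Nat using (ℕ; zero; suc; _+_; _*_; _<_; _<ᵇ_; _≥_)
open import Data.Bool using (Bool; true; false; _∧_; _∨_; if_then_else_; not)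
open import Data.Fin using (Fin; zero; suc; toℕ; _≟_)
open import Data.Nat.ListAction using (sum)
open import Data.List using (List; []; _∷_; map; filter; length; allFin; concatMap)
open import Data.List.Relation.Unary.Unique.Propositional using (Unique)
open import Data.List.Relation.Unary.Linked using (Linked)
open import Data.List.NonEmpty using (List⁺; _∷_; head; last; toList)
import Data.List.NonEmpty as L⁺
open import Data.Product using (∃; _×_; Σ)
open import Relation.Nullary using (¬_; does)
open import Relation.Binary.PropositionalEquality using (_≡_)

record Graph (n : ℕ) : Set where
  field
    adj    : Fin n → Fin n → Bool
    sym    : ∀ x y → adj x y ≡ adj y x
    irrefl : ∀ x → adj x x ≡ false
open Graph public

_==_ : ∀ {n} → Fin n → Fin n → Bool
x == y = does (x ≟ y)

vertices : ∀ n → List (Fin n)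
vertices n = allFin n

anyL : ∀ {A : Set} → (A → Bool) → List A → Bool
anyL p []       = false
anyL p (x ∷ xs) = p x ∨ anyL p xs

count : ∀ {A : Set} → (A → Bool) → List A → ℕ
count p []       = 0
count p (x ∷ xs) = (if p x then 1 else 0) + count p xs

reach : ∀ {n} → Graph n → ℕ → Fin n → Fin n → Bool
reach G zero    x y = x == y
reach G (suc k) x y = reach G k x y ∨ anyL (λ z → adj G x z ∧ reach G k z y) (vertices _)

search : ∀ {n} → Graph n → ℕ → ℕ → Fin n → Fin n → ℕ
search G zero       start x y = start
search G (suc fuel) start x y =
  if reach G start x y then start else search G fuel (suc start) x y

-- Shortest-path distance: the least k with a walk of length ≤ k from x to y.
-- (In a connected graph on n vertices this is < n, so the search with fuel n
-- always finds it.)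
dist : ∀ {n} → Graph n → Fin n → Fin n → ℕ
dist {n} G x y = search G n 0 x y

Connected : ∀ {n} → Graph n → Set
Connected G = ∀ x y → ∃ λ k → reach G k x y ≡ true

record Cycle {n} (G : Graph n) : Set where
  field
    verts    : List⁺ (Fin n)
    long     : 3 Data.Nat.≤ L⁺.length verts
    distinct : Unique (toList verts)
    path     : Linked (λ a b → adj G a b ≡ true) (toList verts)
    closing  : adj G (last verts) (head verts) ≡ true

Acyclic : ∀ {n} → Graph n → Set
Acyclic G = ¬ Cycle G

IsTree : ∀ {n} → Graph n → Set
IsTree G = Connected G × Acyclic G

deg : ∀ {n} → Graph n → Fin n → ℕ
deg G x = count (adj G x) (vertices _)

nClose : ∀ {n} → Graph n → Fin n → Fin n → ℕ
nClose G u v = count (λ x → dist G x u <ᵇ dist G x v) (vertices _)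

-- edges as ordered pairs (u , v) with toℕ u < toℕ v and u ~ v, each edge once
edgeTerm : ∀ {n} → Graph n → Fin n → Fin n → ℕ
edgeTerm G u v =
  if (toℕ u <ᵇ toℕ v) ∧ adj G u v
  then (deg G u + deg G v) * nClose G u v * nClose G v u
  else 0

wSz : ∀ {n} → Graph n → ℕ
wSz {n} G = sum (map (λ u → sum (map (λ v → edgeTerm G u v) (vertices n))) (vertices n))

starAdj : ∀ {m} → Fin (suc m) → Fin (suc m) → Bool
starAdj zero    zero    = false
starAdj zero    (suc _) = true
starAdj (suc _) zero    = true
starAdj (suc _) (suc _) = false

star : ∀ m → Graph (suc m)
star m = record { adj = starAdj ; sym = s ; irrefl = i }
  where
  s : ∀ x y → starAdj x y ≡ starAdj y x
  s zero    zero    = Relation.Binary.PropositionalEquality.refl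
  s zero    (suc _) = Relation.Binary.PropositionalEquality.refl
  s (suc _) zero    = Relation.Binary.PropositionalEquality.refl
  s (suc _) (suc _) = Relation.Binary.PropositionalEquality.refl
  i : ∀ x → starAdj x x ≡ false
  i zero    = Relation.Binary.PropositionalEquality.refl
  i (suc _) = Relation.Binary.PropositionalEquality.refl

-- In a tree on n = m + 1 vertices, fix a vertex u.  Every other vertex has exactly one
-- neighbour of u closer to it, so the sides n_v(uv) of the edges at u partition those m
-- vertices, while n_u(uv) + n_v(uv) ≤ n.  Together with Cauchy–Schwarz,
-- m² ≤ deg(u) ∑_{v~u} n_v(uv)², this gives deg(u) ∑_{v~u} n_u n_v + m² ≤ deg(u) n m.
-- As wSz(T) = ∑_u deg(u) ∑_{v~u} n_u n_v and ∑_u deg(u) = 2m, summing over u yields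
-- wSz(T) ≤ n m², and this is attained by the star: each of its m edges contributes (m + 1) m 1.
module Submission where

open import Data.Bool using (Bool; true; false; if_then_else_; _∧_; _∨_)
open import Data.Bool.Properties using (T-≡; ∨-zeroʳ; ∧-zeroʳ)
open import Data.Fin using (Fin; zero; suc; _≟_; toℕ)
open import Data.Fin.Properties using (punchInᵢ≢i; pigeonhole; toℕ-injective)
import Data.Fin.Properties as Fin
open import Data.List using (List; []; _∷_; length; tabulate; map; lookup; initLast; _∷ʳ′_)
open import Data.List.Membership.Propositional using (_∈_; _∉_)
open import Data.List.Membership.Propositional.Properties using (∈-lookup; ∈-allFin)
open import Data.List.Relation.Binary.Subset.Propositional using (_⊆_)
open import Data.List.Relation.Unary.All as All using ([])
open import Data.List.Relation.Unary.All.Properties using (¬Any⇒All¬)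
open import Data.List.Relation.Unary.Any using (here; there)
open import Data.List.Relation.Unary.AllPairs using ([]; _∷_)
open import Data.List.Relation.Unary.Linked using (Linked; [-]; _∷_)
open import Data.List.Relation.Unary.Unique.Propositional using (Unique)
open import Data.List.NonEmpty using (_∷_; last)
import Data.Nat.ListAction as List
open import Data.Nat using (ℕ; zero; suc; _+_; _*_; _≤_; _<_; _<ᵇ_; _≤?_; z≤n; s≤s)
open import Data.Nat.Properties hiding (_≟_)
open import Data.Nat.Tactic.RingSolver using (solve-∀)
open import Data.Product using (Σ; ∃; _×_; _,_)
open import Data.Sum using (_⊎_; inj₁; inj₂; [_,_]′)
open import Data.Vec.Functional using (removeAt)
open import Function using (_∘_; Equivalence)
open import Relation.Binary.Consequences using (wlog)
open import Relation.Binary.PropositionalEquality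
open import Relation.Nullary using (yes; no; contradiction)
open import Relation.Nullary.Decidable using (dec-true; decidable-stable)

open import Algebra.Properties.Semiring.Sum +-*-semiring
  using (sum; sum-syntax; sum-cong-≗; sum-remove; ∑-distrib-+; ∑-comm; *-distribˡ-sum; *-distribʳ-sum)

open import Defs hiding (sym)

𝟙 : Bool → ℕ
𝟙 b = if b then 1 else 0

sum-mono-≤ : ∀ {n} {f g : Fin n → ℕ} → (∀ i → f i ≤ g i) → sum f ≤ sum g
sum-mono-≤ {zero}  f≤g = z≤n
sum-mono-≤ {suc n} f≤g = +-mono-≤ (f≤g zero) (sum-mono-≤ (f≤g ∘ suc))

sum-const : ∀ n c → ∑[ i < n ] c ≡ n * c
sum-const zero    c = refl
sum-const (suc n) c = cong (c +_) (sum-const n c)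

term≤sum : ∀ {n} (f : Fin n → ℕ) i → f i ≤ sum f
term≤sum f zero    = m≤m+n _ _
term≤sum f (suc i) = ≤-trans (term≤sum (f ∘ suc) i) (m≤n+m _ _)

sum-pointed : ∀ {n} {f : Fin (suc n) → ℕ} {a b} y →
              f y ≡ a → (∀ i → i ≢ y → f i ≡ b) → sum f ≡ a + n * b
sum-pointed {n} {f} {a} {b} y fy≡a rest = begin
  sum f                      ≡⟨ sum-remove f ⟩
  f y + sum (removeAt f y)   ≡⟨ cong₂ _+_ fy≡a (sum-cong-≗ λ i → rest _ (punchInᵢ≢i y i)) ⟩
  a + ∑[ i < n ] b           ≡⟨ cong (a +_) (sum-const n b) ⟩
  a + n * b                  ∎
  where open ≡-Reasoning

sum-indicator-singleton : ∀ {n} {f : Fin (suc n) → ℕ} y →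
                          f y ≡ 1 → (∀ i → i ≢ y → f i ≡ 0) → sum f ≡ 1
sum-indicator-singleton {n} y fy≡1 rest = trans (sum-pointed y fy≡1 rest) (cong suc (*-zeroʳ n))

sum-indicator-cosingleton : ∀ {n} {f : Fin (suc n) → ℕ} y →
                            f y ≡ 0 → (∀ i → i ≢ y → f i ≡ 1) → sum f ≡ n
sum-indicator-cosingleton {n} y fy≡0 rest = trans (sum-pointed y fy≡0 rest) (*-identityʳ n)

∑∑-+-transpose : ∀ {n} (f : Fin n → Fin n → ℕ) →
                 ∑[ i < n ] ∑[ j < n ] (f i j + f j i) ≡ ∑[ i < n ] ∑[ j < n ] f i j + ∑[ i < n ] ∑[ j < n ] f i j
∑∑-+-transpose {n} f = begin
  ∑[ i < n ] ∑[ j < n ] (f i j + f j i)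
    ≡⟨ sum-cong-≗ (λ i → ∑-distrib-+ (f i) (λ j → f j i)) ⟩
  ∑[ i < n ] (∑[ j < n ] f i j + ∑[ j < n ] f j i)
    ≡⟨ ∑-distrib-+ (λ i → ∑[ j < n ] f i j) (λ i → ∑[ j < n ] f j i) ⟩
  ∑[ i < n ] ∑[ j < n ] f i j + ∑[ i < n ] ∑[ j < n ] f j i
    ≡⟨ cong (∑[ i < n ] ∑[ j < n ] f i j +_) (∑-comm (λ i j → f j i)) ⟩
  ∑[ i < n ] ∑[ j < n ] f i j + ∑[ i < n ] ∑[ j < n ] f i j ∎
  where open ≡-Reasoning

m+m≡n+n⇒m≡n : ∀ {m n} → m + m ≡ n + n → m ≡ n
m+m≡n+n⇒m≡n {m} {n} eq = *-cancelˡ-≡ m n 2 (begin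
  2 * m    ≡⟨ cong (m +_) (+-identityʳ m) ⟩
  m + m    ≡⟨ eq ⟩
  n + n    ≡⟨ cong (n +_) (+-identityʳ n) ⟨
  2 * n    ∎)
  where open ≡-Reasoning

sum-tabulate : ∀ {A : Set} {n} (f : Fin n → A) (g : A → ℕ) →
               List.sum (map g (tabulate f)) ≡ ∑[ i < n ] g (f i)
sum-tabulate {n = zero}  f g = refl
sum-tabulate {n = suc n} f g = cong (g (f zero) +_) (sum-tabulate (f ∘ suc) g)

count-tabulate : ∀ {A : Set} {n} (f : Fin n → A) (p : A → Bool) →
                 count p (tabulate f) ≡ ∑[ i < n ] 𝟙 (p (f i))
count-tabulate {n = zero}  f p = refl
count-tabulate {n = suc n} f p = cong (𝟙 (p (f zero)) +_) (count-tabulate (f ∘ suc) p)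

sum-*-sum : ∀ {m n} (f : Fin m → ℕ) (g : Fin n → ℕ) →
            sum f * sum g ≡ ∑[ i < m ] ∑[ j < n ] (f i * g j)
sum-*-sum f g = trans (*-distribʳ-sum (sum g) f) (sum-cong-≗ λ i → *-distribˡ-sum (f i) g)

2*-≤-sq+sq : ∀ x y → 2 * (x * y) ≤ x * x + y * y
2*-≤-sq+sq = wlog ≤-total (λ {x} {y} → symmetric {x} {y}) ordered
  where
  symmetric : ∀ {x y} → 2 * (x * y) ≤ x * x + y * y → 2 * (y * x) ≤ y * y + x * x
  symmetric {x} {y} = subst₂ _≤_ (cong (2 *_) (*-comm x y)) (+-comm (x * x) (y * y))
  ordered : ∀ x y → x ≤ y → 2 * (x * y) ≤ x * x + y * y
  ordered x y x≤y with k , refl ← m≤n⇒∃[o]m+o≡n x≤y =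
    subst (2 * (x * (x + k)) ≤_) (expand x k) (m≤m+n _ (k * k))
    where
    expand : ∀ x k → 2 * (x * (x + k)) + k * k ≡ x * x + (x + k) * (x + k)
    expand = solve-∀

cauchy-schwarz : ∀ {n} (w s : Fin n → ℕ) →
                 (∑[ i < n ] (w i * s i)) * (∑[ i < n ] (w i * s i)) ≤ sum w * ∑[ i < n ] (w i * (s i * s i))
cauchy-schwarz {n} w s = *-cancelˡ-≤ 2 (begin
  2 * (A * A)
    ≡⟨ cong (2 *_) (sum-*-sum ws ws) ⟩
  2 * ∑[ i < n ] ∑[ j < n ] (ws i * ws j)
    ≡⟨ *-distribˡ-sum 2 (λ i → ∑[ j < n ] (ws i * ws j)) ⟩
  ∑[ i < n ] (2 * ∑[ j < n ] (ws i * ws j))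
    ≡⟨ sum-cong-≗ (λ i → *-distribˡ-sum 2 (λ j → ws i * ws j)) ⟩
  ∑[ i < n ] ∑[ j < n ] (2 * (ws i * ws j))
    ≤⟨ sum-mono-≤ (λ i → sum-mono-≤ (pairwise i)) ⟩
  ∑[ i < n ] ∑[ j < n ] (wss i * w j + w i * wss j)
    ≡⟨ sum-cong-≗ (λ i → ∑-distrib-+ (λ j → wss i * w j) (λ j → w i * wss j)) ⟩
  ∑[ i < n ] (∑[ j < n ] (wss i * w j) + ∑[ j < n ] (w i * wss j))
    ≡⟨ ∑-distrib-+ (λ i → ∑[ j < n ] (wss i * w j)) (λ i → ∑[ j < n ] (w i * wss j)) ⟩
  ∑[ i < n ] ∑[ j < n ] (wss i * w j) + ∑[ i < n ] ∑[ j < n ] (w i * wss j)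
    ≡⟨ cong₂ _+_ (sum-*-sum wss w) (sum-*-sum w wss) ⟨
  Q * W + W * Q
    ≡⟨ cong (_+ W * Q) (*-comm Q W) ⟩
  W * Q + W * Q
    ≡⟨ cong (W * Q +_) (+-identityʳ (W * Q)) ⟨
  2 * (W * Q) ∎)
  where
  open ≤-Reasoning
  ws wss : Fin n → ℕ
  ws i = w i * s i
  wss i = w i * (s i * s i)
  A Q W : ℕ
  A = sum ws
  Q = sum wss
  W = sum w
  pairwise : ∀ i j → 2 * (ws i * ws j) ≤ wss i * w j + w i * wss j
  pairwise i j = subst₂ _≤_ (rearrange (w i) (w j) (s i) (s j)) (rearrange′ (w i) (w j) (s i) (s j))
                   (*-monoʳ-≤ (w i * w j) (2*-≤-sq+sq (s i) (s j)))
    where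
    rearrange : ∀ a b x y → a * b * (2 * (x * y)) ≡ 2 * (a * x * (b * y))
    rearrange = solve-∀
    rearrange′ : ∀ a b x y → a * b * (x * x + y * y) ≡ a * (x * x) * b + a * (b * (y * y))
    rearrange′ = solve-∀

-- For w the adjacency row of a vertex u, s v = n_v(uv) and t v = n_u(uv), this is the
-- per-vertex inequality of the proof.
weighted-product-bound : ∀ {n} (w s t : Fin n → ℕ) k S → (∀ i → s i + t i ≤ k) →
                         ∑[ i < n ] (w i * s i) ≡ S →
                         sum w * ∑[ i < n ] (w i * (s i * t i)) + S * S ≤ sum w * (k * S)
weighted-product-bound {n} w s t k S s+t≤k ∑ws≡S = begin
  W * X + S * S
    ≤⟨ +-monoʳ-≤ (W * X) (subst (λ a → a * a ≤ W * Q) ∑ws≡S (cauchy-schwarz w s)) ⟩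
  W * X + W * Q
    ≡⟨ *-distribˡ-+ W X Q ⟨
  W * (X + Q)
    ≡⟨ cong (W *_) (∑-distrib-+ (λ i → w i * (s i * t i)) (λ i → w i * (s i * s i))) ⟨
  W * ∑[ i < n ] (w i * (s i * t i) + w i * (s i * s i))
    ≤⟨ *-monoʳ-≤ W (sum-mono-≤ termwise) ⟩
  W * ∑[ i < n ] (k * (w i * s i))
    ≡⟨ cong (W *_) (*-distribˡ-sum k (λ i → w i * s i)) ⟨
  W * (k * ∑[ i < n ] (w i * s i))
    ≡⟨ cong (λ a → W * (k * a)) ∑ws≡S ⟩
  W * (k * S) ∎
  where
  open ≤-Reasoning
  W X Q : ℕ
  W = sum w
  X = ∑[ i < n ] (w i * (s i * t i))
  Q = ∑[ i < n ] (w i * (s i * s i))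
  termwise : ∀ i → w i * (s i * t i) + w i * (s i * s i) ≤ k * (w i * s i)
  termwise i = subst₂ _≤_ (factor (w i) (s i) (t i)) (*-comm (w i * s i) k)
                 (*-monoʳ-≤ (w i * s i) (subst (_≤ k) (+-comm (s i) (t i)) (s+t≤k i)))
    where
    factor : ∀ a x y → a * x * (y + x) ≡ a * (x * y) + a * (x * x)
    factor = solve-∀

Unique-lookup-injective : ∀ {A : Set} {xs : List A} → Unique xs →
                          ∀ {i j} → lookup xs i ≡ lookup xs j → i ≡ j
Unique-lookup-injective (_     ∷ _) {zero}  {zero}  _  = refl
Unique-lookup-injective (x∉xs ∷ _) {zero}  {suc j} eq = contradiction eq (All.lookup x∉xs (∈-lookup j))
Unique-lookup-injective (x∉xs ∷ _) {suc i} {zero}  eq = contradiction (sym eq) (All.lookup x∉xs (∈-lookup i))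
Unique-lookup-injective (_ ∷ u)    {suc i} {suc j} eq = cong suc (Unique-lookup-injective u eq)

Unique⇒length≤ : ∀ {n} {xs : List (Fin n)} → Unique xs → length xs ≤ n
Unique⇒length≤ {n} {xs} u with length xs ≤? n
... | yes ok  = ok
... | no long with i , j , i<j , eq ← pigeonhole (≰⇒> long) (lookup xs) =
  contradiction (Unique-lookup-injective u eq) (Fin.<⇒≢ i<j)

==⇒≡ : ∀ {n} {x y : Fin n} → (x == y) ≡ true → x ≡ y
==⇒≡ {x = x} {y} x==y with x ≟ y
... | yes x≡y = x≡y

==-refl : ∀ {n} (x : Fin n) → (x == x) ≡ true
==-refl x = dec-true (x ≟ x) refl

anyL-sound : ∀ {A : Set} (p : A → Bool) xs → anyL p xs ≡ true → ∃ λ x → p x ≡ true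
anyL-sound p (x ∷ xs) any≡true with p x in px≡true
... | true  = x , px≡true
... | false = anyL-sound p xs any≡true

anyL-complete : ∀ {A : Set} (p : A → Bool) {xs x} → x ∈ xs → p x ≡ true → anyL p xs ≡ true
anyL-complete p {_ ∷ _}  (here refl) px≡true rewrite px≡true = refl
anyL-complete p {y ∷ xs} (there x∈xs) px≡true =
  trans (cong (p y ∨_) (anyL-complete p x∈xs px≡true)) (∨-zeroʳ (p y))

module Walks {n} (G : Graph n) where

  open import Data.List.Membership.DecPropositional (_≟_ {n}) using (_∈?_)

  infix 4 _~_
  _~_ : Fin n → Fin n → Set
  x ~ y = adj G x y ≡ true

  ~-sym : ∀ {x y} → x ~ y → y ~ x
  ~-sym {x} {y} x~y = trans (Graph.sym G y x) x~y

  ~-irrefl : ∀ {x y} → x ~ y → x ≢ y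
  ~-irrefl {x} x~x refl with () ← trans (sym x~x) (irrefl G x)

  infixr 5 _∷_ _++ʷ_

  data Walk : Fin n → Fin n → Set where
    []  : ∀ {x} → Walk x x
    _∷_ : ∀ {x y z} → x ~ y → Walk y z → Walk x z

  walkLength : ∀ {x y} → Walk x y → ℕ
  walkLength []      = 0
  walkLength (_ ∷ p) = suc (walkLength p)

  support : ∀ {x y} → Walk x y → List (Fin n)
  support {x} []      = x ∷ []
  support {x} (_ ∷ p) = x ∷ support p

  _++ʷ_ : ∀ {x y z} → Walk x y → Walk y z → Walk x z
  []      ++ʷ q = q
  (e ∷ p) ++ʷ q = e ∷ (p ++ʷ q)

  reverseʷ : ∀ {x y} → Walk x y → Walk y x
  reverseʷ []      = []
  reverseʷ (e ∷ p) = reverseʷ p ++ʷ (~-sym e ∷ [])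

  length-++ʷ : ∀ {x y z} (p : Walk x y) (q : Walk y z) →
               walkLength (p ++ʷ q) ≡ walkLength p + walkLength q
  length-++ʷ []      q = refl
  length-++ʷ (_ ∷ p) q = cong suc (length-++ʷ p q)

  length-reverseʷ : ∀ {x y} (p : Walk x y) → walkLength (reverseʷ p) ≡ walkLength p
  length-reverseʷ []      = refl
  length-reverseʷ (e ∷ p) = begin
    walkLength (reverseʷ p ++ʷ (~-sym e ∷ []))  ≡⟨ length-++ʷ (reverseʷ p) _ ⟩
    walkLength (reverseʷ p) + 1                 ≡⟨ +-comm _ 1 ⟩
    suc (walkLength (reverseʷ p))               ≡⟨ cong suc (length-reverseʷ p) ⟩
    suc (walkLength p)                          ∎
    where open ≡-Reasoning

  length-support : ∀ {x y} (p : Walk x y) → length (support p) ≡ suc (walkLength p)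
  length-support []      = refl
  length-support (_ ∷ p) = cong suc (length-support p)

  start∈support : ∀ {x y} (p : Walk x y) → x ∈ support p
  start∈support []      = here refl
  start∈support (_ ∷ _) = here refl

  ∈-++ʷ⁻ : ∀ {x y z u} (p : Walk x y) (q : Walk y z) →
           u ∈ support (p ++ʷ q) → u ∈ support p ⊎ u ∈ support q
  ∈-++ʷ⁻ []      q u∈q          = inj₂ u∈q
  ∈-++ʷ⁻ (_ ∷ p) q (here refl)  = inj₁ (here refl)
  ∈-++ʷ⁻ (_ ∷ p) q (there u∈pq) with ∈-++ʷ⁻ p q u∈pq
  ... | inj₁ u∈p = inj₁ (there u∈p)
  ... | inj₂ u∈q = inj₂ u∈q

  ∈-reverseʷ⁻ : ∀ {x y u} (p : Walk x y) → u ∈ support (reverseʷ p) → u ∈ support p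
  ∈-reverseʷ⁻ []      u∈p = u∈p
  ∈-reverseʷ⁻ (e ∷ p) u∈rp with ∈-++ʷ⁻ (reverseʷ p) (~-sym e ∷ []) u∈rp
  ... | inj₁ u∈p                  = there (∈-reverseʷ⁻ p u∈p)
  ... | inj₂ (here refl)          = there (start∈support p)
  ... | inj₂ (there (here refl))  = here refl

  dropUntil : ∀ {x y z} (p : Walk x y) → z ∈ support p → Walk z y
  dropUntil []      (here refl)  = []
  dropUntil (e ∷ p) (here refl)  = e ∷ p
  dropUntil (_ ∷ p) (there z∈p)  = dropUntil p z∈p

  length-dropUntil≤ : ∀ {x y z} (p : Walk x y) (z∈p : z ∈ support p) →
                      walkLength (dropUntil p z∈p) ≤ walkLength p
  length-dropUntil≤ []      (here refl) = ≤-refl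
  length-dropUntil≤ (_ ∷ p) (here refl) = ≤-refl
  length-dropUntil≤ (_ ∷ p) (there z∈p) = m≤n⇒m≤1+n (length-dropUntil≤ p z∈p)

  length-dropUntil< : ∀ {x y z} (p : Walk x y) (z∈p : z ∈ support p) → z ≢ x →
                      walkLength (dropUntil p z∈p) < walkLength p
  length-dropUntil< []      (here refl) z≢x = contradiction refl z≢x
  length-dropUntil< (_ ∷ p) (here refl) z≢x = contradiction refl z≢x
  length-dropUntil< (_ ∷ p) (there z∈p) _   = s≤s (length-dropUntil≤ p z∈p)

  support-dropUntil⊆ : ∀ {x y z} (p : Walk x y) (z∈p : z ∈ support p) →
                       support (dropUntil p z∈p) ⊆ support p
  support-dropUntil⊆ []      (here refl) = λ u∈ → u∈
  support-dropUntil⊆ (_ ∷ p) (here refl) = λ u∈ → u∈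
  support-dropUntil⊆ (_ ∷ p) (there z∈p) = there ∘ support-dropUntil⊆ p z∈p

  dropUntil-unique : ∀ {x y z} (p : Walk x y) (z∈p : z ∈ support p) →
                     Unique (support p) → Unique (support (dropUntil p z∈p))
  dropUntil-unique []      (here refl) u       = u
  dropUntil-unique (_ ∷ p) (here refl) u       = u
  dropUntil-unique (_ ∷ p) (there z∈p) (_ ∷ u) = dropUntil-unique p z∈p u

  toPath : ∀ {x y} (p : Walk x y) → Σ (Walk x y) λ q → Unique (support q) × support q ⊆ support p
  toPath []      = [] , [] ∷ [] , λ u∈ → u∈
  toPath {x} (e ∷ p) with q , q-unique , q⊆p ← toPath p with x ∈? support q
  ... | yes x∈q = dropUntil q x∈q , dropUntil-unique q x∈q q-unique , there ∘ q⊆p ∘ support-dropUntil⊆ q x∈q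
  ... | no  x∉q = e ∷ q , ¬Any⇒All¬ _ x∉q ∷ q-unique , λ { (here refl) → here refl ; (there u∈q) → there (q⊆p u∈q) }

  reach-suc : ∀ {k x y} → reach G k x y ≡ true → reach G (suc k) x y ≡ true
  reach-suc reached rewrite reached = refl

  walk⇒reach : ∀ {x y k} (p : Walk x y) → walkLength p ≤ k → reach G k x y ≡ true
  walk⇒reach {x} {k = zero}  [] _ = ==-refl x
  walk⇒reach     {k = suc k} [] _ = reach-suc {k} (walk⇒reach {k = k} [] z≤n)
  walk⇒reach {x} {y} {suc k} (_∷_ {y = z} x~z p) (s≤s p≤k) =
    trans (cong (reach G k x y ∨_) via-z) (∨-zeroʳ _)
    where
    via-z : anyL (λ w → adj G x w ∧ reach G k w y) (vertices n) ≡ true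
    via-z = anyL-complete _ (∈-allFin z) (cong₂ _∧_ x~z (walk⇒reach p p≤k))

  reach⇒walk : ∀ k {x y} → reach G k x y ≡ true → Σ (Walk x y) λ p → walkLength p ≤ k
  reach⇒walk zero {x} {y} x==y with refl ← ==⇒≡ {x = x} {y} x==y = [] , z≤n
  reach⇒walk (suc k) {x} {y} reached with reach G k x y in reached-k
  ... | true with p , p≤k ← reach⇒walk k reached-k = p , m≤n⇒m≤1+n p≤k
  ... | false
    with z , x~z∧reach ← anyL-sound _ (vertices n) reached
    with adj G x z in x~z
  ... | true with p , p≤k ← reach⇒walk k x~z∧reach = x~z ∷ p , s≤s p≤k

  linked-support : ∀ {x y} (p : Walk x y) → Linked _~_ (support p)
  linked-support []             = [-]
  linked-support (e ∷ [])       = e ∷ [-]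
  linked-support (e ∷ e′ ∷ p)   = e ∷ linked-support (e′ ∷ p)

  last-∷ : ∀ (x y : Fin n) ys → last (x ∷ y ∷ ys) ≡ last (y ∷ ys)
  last-∷ x y ys with initLast ys
  ... | []       = refl
  ... | _ ∷ʳ′ _  = refl

  last-support : ∀ u {x y} (p : Walk x y) → last (u ∷ support p) ≡ y
  last-support u {x} []      = last-∷ u x []
  last-support u {x} (_ ∷ p) = trans (last-∷ u x (support p)) (last-support x p)

  walk-between-neighbours-visits : Acyclic G → ∀ {u v w} → u ~ v → u ~ w → v ≢ w →
                                   (p : Walk v w) → u ∈ support p
  walk-between-neighbours-visits acyclic {u} {v} {w} u~v u~w v≢w p
    with q , q-unique , q⊆p ← toPath p =
    decidable-stable (u ∈? support p) λ u∉p → acyclic (cycle q q-unique (u∉p ∘ q⊆p))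
    where
    cycle : (q : Walk v w) → Unique (support q) → u ∉ support q → Cycle G
    cycle []       _        _   = contradiction refl v≢w
    cycle (e ∷ q′) q-unique u∉q = record
      { verts    = u ∷ support (e ∷ q′)
      ; long     = s≤s (s≤s (subst (1 ≤_) (sym (length-support q′)) (s≤s z≤n)))
      ; distinct = ¬Any⇒All¬ _ u∉q ∷ q-unique
      ; path     = u~v ∷ linked-support (e ∷ q′)
      ; closing  = subst (_~ u) (sym (last-support u (e ∷ q′))) (~-sym u~w)
      }

  search-≤ : ∀ fuel {s k x y} → s ≤ k → reach G k x y ≡ true → search G fuel s x y ≤ k
  search-≤ zero       s≤k _ = s≤k
  search-≤ (suc fuel) {s} {k} {x} {y} s≤k reached with reach G s x y in reached-s
  ... | true  = s≤k
  ... | false = search-≤ fuel (≤∧≢⇒< s≤k s≢k) reached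
    where
    s≢k : s ≢ k
    s≢k refl with () ← trans (sym reached-s) reached

  search-reaches : ∀ fuel {s x y} → reach G (fuel + s) x y ≡ true →
                   reach G (search G (suc fuel) s x y) x y ≡ true
  search-reaches fuel {s} {x} {y} reached with reach G s x y in reached-s
  ... | true = reached-s
  search-reaches zero       reached | false with () ← trans (sym reached-s) reached
  search-reaches (suc fuel) {s} {x} {y} reached | false =
    search-reaches fuel (subst (λ k → reach G k x y ≡ true) (sym (+-suc fuel s)) reached)

  dist-≤-length : ∀ {x y} (p : Walk x y) → dist G x y ≤ walkLength p
  dist-≤-length p = search-≤ n z≤n (walk⇒reach p ≤-refl)

  dist-self : ∀ x → dist G x x ≡ 0
  dist-self x = n≤0⇒n≡0 (dist-≤-length {x} [])

module ConnectedDistances {m} (G : Graph (suc m)) (connected : Connected G) where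

  open Walks G

  -- dist only tries lengths below n; a path is short enough, having distinct vertices.
  reach-dist : ∀ x y → reach G (dist G x y) x y ≡ true
  reach-dist x y
    with k , reached ← connected x y
    with p , _ ← reach⇒walk k reached
    with q , q-unique , _ ← toPath p =
    search-reaches m (subst (λ k → reach G k x y ≡ true) (sym (+-identityʳ m)) (walk⇒reach q q≤m))
    where
    q≤m : walkLength q ≤ m
    q≤m = ≤-pred (subst (_≤ suc m) (length-support q) (Unique⇒length≤ q-unique))

  shortest-walk : ∀ x y → Σ (Walk x y) λ p → walkLength p ≡ dist G x y
  shortest-walk x y with p , p≤dist ← reach⇒walk _ (reach-dist x y) =
    p , ≤-antisym p≤dist (dist-≤-length p)

  dist-sym : ∀ x y → dist G x y ≡ dist G y x
  dist-sym x y = ≤-antisym (reverse-≤ y x) (reverse-≤ x y)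
    where
    reverse-≤ : ∀ a b → dist G b a ≤ dist G a b
    reverse-≤ a b with p , p≡dist ← shortest-walk a b =
      ≤-trans (dist-≤-length (reverseʷ p)) (≤-reflexive (trans (length-reverseʷ p) p≡dist))

  dist≡0⇒≡ : ∀ {x y} → dist G x y ≡ 0 → x ≡ y
  dist≡0⇒≡ {x} {y} d≡0 = ==⇒≡ (subst (λ k → reach G k x y ≡ true) d≡0 (reach-dist x y))

  ≢⇒dist>0 : ∀ {x y} → x ≢ y → 0 < dist G x y
  ≢⇒dist>0 x≢y = n≢0⇒n>0 (x≢y ∘ dist≡0⇒≡)

  shortest-walk-avoids : ∀ {a b z} (p : Walk a b) → z ≢ a → walkLength p ≤ dist G z b → z ∉ support p
  shortest-walk-avoids p z≢a p≤dist z∈p =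
    <⇒≱ (<-≤-trans (length-dropUntil< p z∈p z≢a) p≤dist) (dist-≤-length (dropUntil p z∈p))

  closer-neighbour : ∀ {x u} → x ≢ u → ∃ λ v → u ~ v × dist G x v < dist G x u
  closer-neighbour {x} {u} x≢u with shortest-walk u x
  ... | [] , _ = contradiction refl x≢u
  ... | _∷_ {y = v} u~v p , 1+p≡dist = v , u~v , (begin-strict
    dist G x v          ≡⟨ dist-sym x v ⟩
    dist G v x          ≤⟨ dist-≤-length p ⟩
    walkLength p        <⟨ n<1+n _ ⟩
    suc (walkLength p)  ≡⟨ 1+p≡dist ⟩
    dist G u x          ≡⟨ dist-sym u x ⟩
    dist G x u          ∎)
    where open ≤-Reasoning

module TreeDistances {m} (G : Graph (suc m)) (connected : Connected G) (acyclic : Acyclic G) where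

  open Walks G
  open ConnectedDistances G connected

  walk-avoiding : ∀ {u v z} → u ~ v → dist G z v ≤ dist G z u → Σ (Walk v z) λ p → u ∉ support p
  walk-avoiding {u} {v} {z} u~v dv≤du with p , p≡dist ← shortest-walk v z =
    p , shortest-walk-avoids p (~-irrefl u~v) (begin
      walkLength p  ≡⟨ p≡dist ⟩
      dist G v z    ≡⟨ dist-sym v z ⟩
      dist G z v    ≤⟨ dv≤du ⟩
      dist G z u    ≡⟨ dist-sym z u ⟩
      dist G u z    ∎)
    where open ≤-Reasoning

  not-farther-neighbour-unique : ∀ {z u v w} → u ~ v → u ~ w →
                                 dist G z v ≤ dist G z u → dist G z w ≤ dist G z u → v ≡ w
  not-farther-neighbour-unique {z} {u} {v} {w} u~v u~w dv≤du dw≤du with v ≟ w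
  ... | yes v≡w = v≡w
  ... | no  v≢w
    with pv , u∉pv ← walk-avoiding u~v dv≤du
    with pw , u∉pw ← walk-avoiding u~w dw≤du =
    contradiction (walk-between-neighbours-visits acyclic u~v u~w v≢w (pv ++ʷ reverseʷ pw))
      (λ u∈ → [ u∉pv , u∉pw ∘ ∈-reverseʷ⁻ pw ]′ (∈-++ʷ⁻ pv (reverseʷ pw) u∈))

  dist-≢-across-edge : ∀ r {u v} → u ~ v → dist G r u ≢ dist G r v
  dist-≢-across-edge r {u} {v} u~v du≡dv with v ≟ r
  ... | yes refl = ~-irrefl u~v (sym (dist≡0⇒≡ (trans du≡dv (dist-self r))))
  ... | no  v≢r with p , v~p , dp<dv ← closer-neighbour (v≢r ∘ sym) =
    <-irrefl du≡dv (subst (λ q → dist G r q < dist G r v) (sym u≡p) dp<dv)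
    where
    u≡p : u ≡ p
    u≡p = not-farther-neighbour-unique (~-sym u~v) v~p (≤-reflexive du≡dv) (<⇒≤ dp<dv)

𝟙<ᵇ+𝟙>ᵇ≤1 : ∀ p q → 𝟙 (p <ᵇ q) + 𝟙 (q <ᵇ p) ≤ 1
𝟙<ᵇ+𝟙>ᵇ≤1 zero    zero    = z≤n
𝟙<ᵇ+𝟙>ᵇ≤1 zero    (suc q) = ≤-refl
𝟙<ᵇ+𝟙>ᵇ≤1 (suc p) zero    = ≤-refl
𝟙<ᵇ+𝟙>ᵇ≤1 (suc p) (suc q) = 𝟙<ᵇ+𝟙>ᵇ≤1 p q

≢⇒𝟙<ᵇ+𝟙>ᵇ≡1 : ∀ {p q} → p ≢ q → 𝟙 (p <ᵇ q) + 𝟙 (q <ᵇ p) ≡ 1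
≢⇒𝟙<ᵇ+𝟙>ᵇ≡1 {zero}  {zero}  p≢q = contradiction refl p≢q
≢⇒𝟙<ᵇ+𝟙>ᵇ≡1 {zero}  {suc q} _   = refl
≢⇒𝟙<ᵇ+𝟙>ᵇ≡1 {suc p} {zero}  _   = refl
≢⇒𝟙<ᵇ+𝟙>ᵇ≡1 {suc p} {suc q} p≢q = ≢⇒𝟙<ᵇ+𝟙>ᵇ≡1 (p≢q ∘ cong suc)

if-<ᵇ-+-if->ᵇ : ∀ {p q} x y → p ≢ q → x ≡ y →
                (if (p <ᵇ q) ∧ true then x else 0) + (if (q <ᵇ p) ∧ true then y else 0) ≡ x
if-<ᵇ-+-if->ᵇ {zero}  {zero}  x y p≢q _   = contradiction refl p≢q
if-<ᵇ-+-if->ᵇ {zero}  {suc q} x y _   _   = +-identityʳ x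
if-<ᵇ-+-if->ᵇ {suc p} {zero}  x y _   x≡y = sym x≡y
if-<ᵇ-+-if->ᵇ {suc p} {suc q} x y p≢q x≡y = if-<ᵇ-+-if->ᵇ x y (p≢q ∘ cong suc) x≡y

<⇒<ᵇ≡true : ∀ {p q} → p < q → (p <ᵇ q) ≡ true
<⇒<ᵇ≡true = Equivalence.to T-≡ ∘ <⇒<ᵇ

<ᵇ≡true⇒< : ∀ {p q} → (p <ᵇ q) ≡ true → p < q
<ᵇ≡true⇒< {p} {q} = <ᵇ⇒< p q ∘ Equivalence.from T-≡

module SzegedTerms {n} (G : Graph n) where

  open Walks G using (~-irrefl)

  deg≡∑ : ∀ u → deg G u ≡ ∑[ v < n ] 𝟙 (adj G u v)
  deg≡∑ u = count-tabulate (λ v → v) (adj G u)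

  nClose≡∑ : ∀ u v → nClose G u v ≡ ∑[ x < n ] 𝟙 (dist G x u <ᵇ dist G x v)
  nClose≡∑ u v = count-tabulate (λ x → x) (λ x → dist G x u <ᵇ dist G x v)

  nClose-+-nClose≤ : ∀ u v → nClose G u v + nClose G v u ≤ n
  nClose-+-nClose≤ u v = begin
    nClose G u v + nClose G v u
      ≡⟨ cong₂ _+_ (nClose≡∑ u v) (nClose≡∑ v u) ⟩
    ∑[ x < n ] 𝟙 (dist G x u <ᵇ dist G x v) + ∑[ x < n ] 𝟙 (dist G x v <ᵇ dist G x u)
      ≡⟨ ∑-distrib-+ (λ x → 𝟙 (dist G x u <ᵇ dist G x v)) (λ x → 𝟙 (dist G x v <ᵇ dist G x u)) ⟨
    ∑[ x < n ] (𝟙 (dist G x u <ᵇ dist G x v) + 𝟙 (dist G x v <ᵇ dist G x u))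
      ≤⟨ sum-mono-≤ (λ x → 𝟙<ᵇ+𝟙>ᵇ≤1 (dist G x u) (dist G x v)) ⟩
    ∑[ x < n ] 1
      ≡⟨ sum-const n 1 ⟩
    n * 1
      ≡⟨ *-identityʳ n ⟩
    n ∎
    where open ≤-Reasoning

  szegedProducts : Fin n → ℕ
  szegedProducts u = ∑[ v < n ] (𝟙 (adj G u v) * (nClose G v u * nClose G u v))

  halfEdgeTerm : Fin n → Fin n → ℕ
  halfEdgeTerm u v = deg G u * (𝟙 (adj G u v) * (nClose G v u * nClose G u v))

  edgeTerm-+-edgeTerm : ∀ u v → edgeTerm G u v + edgeTerm G v u ≡ halfEdgeTerm u v + halfEdgeTerm v u
  edgeTerm-+-edgeTerm u v rewrite Graph.sym G v u with adj G u v in u~v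
  ... | false rewrite ∧-zeroʳ (toℕ u <ᵇ toℕ v) | ∧-zeroʳ (toℕ v <ᵇ toℕ u) =
    sym (cong₂ _+_ (*-zeroʳ (deg G u)) (*-zeroʳ (deg G v)))
  ... | true  = trans (if-<ᵇ-+-if->ᵇ _ _ (~-irrefl u~v ∘ toℕ-injective) (reorder (deg G u) (deg G v) _ _))
                      (split (deg G u) (deg G v) (nClose G u v) (nClose G v u))
    where
    reorder : ∀ du dv a b → (du + dv) * a * b ≡ (dv + du) * b * a
    reorder = solve-∀
    split : ∀ du dv a b → (du + dv) * a * b ≡ du * (1 * (b * a)) + dv * (1 * (a * b))
    split = solve-∀

  wSz≡∑∑edgeTerm : wSz G ≡ ∑[ u < n ] ∑[ v < n ] edgeTerm G u v
  wSz≡∑∑edgeTerm = trans (sum-tabulate (λ u → u) (λ u → List.sum (map (edgeTerm G u) (vertices n))))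
                         (sum-cong-≗ λ u → sum-tabulate (λ v → v) (edgeTerm G u))

  wSz≡∑deg*szegedProducts : wSz G ≡ ∑[ u < n ] (deg G u * szegedProducts u)
  wSz≡∑deg*szegedProducts = m+m≡n+n⇒m≡n (begin
    wSz G + wSz G
      ≡⟨ cong₂ _+_ wSz≡∑∑edgeTerm wSz≡∑∑edgeTerm ⟩
    ∑[ u < n ] ∑[ v < n ] edgeTerm G u v + ∑[ u < n ] ∑[ v < n ] edgeTerm G u v
      ≡⟨ ∑∑-+-transpose (edgeTerm G) ⟨
    ∑[ u < n ] ∑[ v < n ] (edgeTerm G u v + edgeTerm G v u)
      ≡⟨ sum-cong-≗ (λ u → sum-cong-≗ (edgeTerm-+-edgeTerm u)) ⟩
    ∑[ u < n ] ∑[ v < n ] (halfEdgeTerm u v + halfEdgeTerm v u)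
      ≡⟨ ∑∑-+-transpose halfEdgeTerm ⟩
    ∑[ u < n ] ∑[ v < n ] halfEdgeTerm u v + ∑[ u < n ] ∑[ v < n ] halfEdgeTerm u v
      ≡⟨ cong₂ _+_ factor factor ⟩
    ∑[ u < n ] (deg G u * szegedProducts u) + ∑[ u < n ] (deg G u * szegedProducts u) ∎)
    where
    open ≡-Reasoning
    factor : ∑[ u < n ] ∑[ v < n ] halfEdgeTerm u v ≡ ∑[ u < n ] (deg G u * szegedProducts u)
    factor = sum-cong-≗ λ u → sym (*-distribˡ-sum (deg G u) λ v → 𝟙 (adj G u v) * (nClose G v u * nClose G u v))

module TreeBound {m} (G : Graph (suc m)) (connected : Connected G) (acyclic : Acyclic G) where

  open Walks G
  open ConnectedDistances G connected
  open TreeDistances G connected acyclic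
  open SzegedTerms G

  -- Summed over x this gives ∑-sides; summed over u, for a fixed root, the handshake lemma.
  closerNeighbours : Fin (suc m) → Fin (suc m) → ℕ
  closerNeighbours x u = ∑[ v < suc m ] (𝟙 (adj G u v) * 𝟙 (dist G x v <ᵇ dist G x u))

  closerNeighbours-self : ∀ u → closerNeighbours u u ≡ 0
  closerNeighbours-self u = begin
    closerNeighbours u u  ≡⟨ sum-cong-≗ (λ v → trans (cong (λ d → 𝟙 (adj G u v) * 𝟙 (dist G u v <ᵇ d)) (dist-self u))
                                                       (*-zeroʳ (𝟙 (adj G u v)))) ⟩
    ∑[ v < suc m ] 0      ≡⟨ sum-const (suc m) 0 ⟩
    suc m * 0             ≡⟨ *-zeroʳ (suc m) ⟩
    0                     ∎
    where open ≡-Reasoning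

  closerNeighbours-≢ : ∀ {x u} → x ≢ u → closerNeighbours x u ≡ 1
  closerNeighbours-≢ {x} {u} x≢u with v , u~v , dv<du ← closer-neighbour x≢u =
    sum-indicator-singleton v (cong₂ (λ a b → 𝟙 a * 𝟙 b) u~v (<⇒<ᵇ≡true dv<du)) others
    where
    others : ∀ w → w ≢ v → 𝟙 (adj G u w) * 𝟙 (dist G x w <ᵇ dist G x u) ≡ 0
    others w w≢v with adj G u w in u~w | dist G x w <ᵇ dist G x u in dw<du
    ... | false | _     = refl
    ... | true  | false = refl
    ... | true  | true  =
      contradiction (not-farther-neighbour-unique u~w u~v (<⇒≤ (<ᵇ≡true⇒< dw<du)) (<⇒≤ dv<du)) w≢v

  ∑-closerNeighbours : ∀ x → ∑[ u < suc m ] closerNeighbours x u ≡ m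
  ∑-closerNeighbours x =
    sum-indicator-cosingleton x (closerNeighbours-self x) (λ u u≢x → closerNeighbours-≢ (u≢x ∘ sym))

  ∑-sides : ∀ u → ∑[ v < suc m ] (𝟙 (adj G u v) * nClose G v u) ≡ m
  ∑-sides u = begin
    ∑[ v < suc m ] (𝟙 (adj G u v) * nClose G v u)
      ≡⟨ sum-cong-≗ (λ v → trans (cong (𝟙 (adj G u v) *_) (nClose≡∑ v u)) (*-distribˡ-sum (𝟙 (adj G u v)) λ x → 𝟙 (dist G x v <ᵇ dist G x u))) ⟩
    ∑[ v < suc m ] ∑[ x < suc m ] (𝟙 (adj G u v) * 𝟙 (dist G x v <ᵇ dist G x u))
      ≡⟨ ∑-comm (λ v x → 𝟙 (adj G u v) * 𝟙 (dist G x v <ᵇ dist G x u)) ⟩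
    ∑[ x < suc m ] closerNeighbours x u
      ≡⟨ sum-indicator-cosingleton u (closerNeighbours-self u) (λ x x≢u → closerNeighbours-≢ x≢u) ⟩
    m ∎
    where open ≡-Reasoning

  ∑deg≡m+m : ∑[ u < suc m ] deg G u ≡ m + m
  ∑deg≡m+m = begin
    ∑[ u < suc m ] deg G u                          ≡⟨ sum-cong-≗ deg≡∑ ⟩
    ∑[ u < suc m ] ∑[ v < suc m ] 𝟙 (adj G u v)     ≡⟨ sum-cong-≗ (λ u → sum-cong-≗ (orient u)) ⟩
    ∑[ u < suc m ] ∑[ v < suc m ] (towardsRoot u v + towardsRoot v u)
                                                    ≡⟨ ∑∑-+-transpose towardsRoot ⟩
    ∑[ u < suc m ] closerNeighbours zero u + ∑[ u < suc m ] closerNeighbours zero u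
                                                    ≡⟨ cong₂ _+_ (∑-closerNeighbours zero) (∑-closerNeighbours zero) ⟩
    m + m                                           ∎
    where
    open ≡-Reasoning
    towardsRoot : Fin (suc m) → Fin (suc m) → ℕ
    towardsRoot u v = 𝟙 (adj G u v) * 𝟙 (dist G zero v <ᵇ dist G zero u)
    orient : ∀ u v → 𝟙 (adj G u v) ≡ towardsRoot u v + towardsRoot v u
    orient u v rewrite Graph.sym G v u with adj G u v in u~v
    ... | false = refl
    ... | true  = sym (trans (cong₂ _+_ (+-identityʳ (𝟙 (dist G zero v <ᵇ dist G zero u)))
                                        (+-identityʳ (𝟙 (dist G zero u <ᵇ dist G zero v))))
                             (≢⇒𝟙<ᵇ+𝟙>ᵇ≡1 (dist-≢-across-edge zero u~v ∘ sym)))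

  vertex-bound : ∀ u → deg G u * szegedProducts u + m * m ≤ deg G u * (suc m * m)
  vertex-bound u = subst (λ d → d * szegedProducts u + m * m ≤ d * (suc m * m)) (sym (deg≡∑ u))
    (weighted-product-bound (λ v → 𝟙 (adj G u v)) (λ v → nClose G v u) (λ v → nClose G u v) (suc m) m
                            (λ v → nClose-+-nClose≤ v u) (∑-sides u))

  wSz-≤ : wSz G ≤ suc m * (m * m)
  wSz-≤ = +-cancelʳ-≤ (suc m * (m * m)) _ _ (begin
    wSz G + suc m * (m * m)
      ≡⟨ cong₂ _+_ wSz≡∑deg*szegedProducts (sym (sum-const (suc m) (m * m))) ⟩
    ∑[ u < suc m ] (deg G u * szegedProducts u) + ∑[ u < suc m ] (m * m)
      ≡⟨ ∑-distrib-+ (λ u → deg G u * szegedProducts u) (λ _ → m * m) ⟨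
    ∑[ u < suc m ] (deg G u * szegedProducts u + m * m)
      ≤⟨ sum-mono-≤ vertex-bound ⟩
    ∑[ u < suc m ] (deg G u * (suc m * m))
      ≡⟨ *-distribʳ-sum (suc m * m) (deg G) ⟨
    (∑[ u < suc m ] deg G u) * (suc m * m)
      ≡⟨ cong (_* (suc m * m)) ∑deg≡m+m ⟩
    (m + m) * (suc m * m)
      ≡⟨ double (suc m) m ⟩
    suc m * (m * m) + suc m * (m * m) ∎)
    where
    open ≤-Reasoning
    double : ∀ n m → (m + m) * (n * m) ≡ n * (m * m) + n * (m * m)
    double = solve-∀

module StarIndex (m : ℕ) where

  open Walks (star m)

  toCentre : ∀ x → Walk x zero
  toCentre zero    = []
  toCentre (suc _) = refl ∷ []

  fromCentre : ∀ y → Walk zero y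
  fromCentre zero    = []
  fromCentre (suc _) = refl ∷ []

  star-connected : Connected (star m)
  star-connected x y = walkLength p , walk⇒reach p ≤-refl
    where
    p : Walk x y
    p = toCentre x ++ʷ fromCentre y

  open ConnectedDistances (star m) star-connected
  open SzegedTerms (star m)

  deg-centre : deg (star m) zero ≡ m
  deg-centre = trans (deg≡∑ zero) (trans (sum-const m 1) (*-identityʳ m))

  deg-leaf : ∀ i → deg (star m) (suc i) ≡ 1
  deg-leaf i = trans (deg≡∑ (suc i)) (cong suc (trans (sum-const m 0) (*-zeroʳ m)))

  dist-leaf-centre≤1 : ∀ j → dist (star m) (suc j) zero ≤ 1
  dist-leaf-centre≤1 j = dist-≤-length (toCentre (suc j))

  dist-between-leaves≥2 : ∀ {i j} → i ≢ j → 2 ≤ dist (star m) (suc i) (suc j)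
  dist-between-leaves≥2 {i} {j} i≢j with shortest-walk (suc i) (suc j)
  ... | []            , _        = contradiction refl i≢j
  ... | (() ∷ [])     , _
  ... | (_ ∷ _ ∷ _)   , len≡dist = subst (2 ≤_) len≡dist (s≤s (s≤s z≤n))

  nClose-centre : ∀ i → nClose (star m) zero (suc i) ≡ m
  nClose-centre i = trans (nClose≡∑ zero (suc i)) (sum-indicator-cosingleton (suc i) not-leaf others)
    where
    not-leaf : 𝟙 (dist (star m) (suc i) zero <ᵇ dist (star m) (suc i) (suc i)) ≡ 0
    not-leaf rewrite dist-self (suc i) = refl
    others : ∀ x → x ≢ suc i → 𝟙 (dist (star m) x zero <ᵇ dist (star m) x (suc i)) ≡ 1
    others zero    _     rewrite dist-self zero = cong 𝟙 (<⇒<ᵇ≡true (≢⇒dist>0 {zero} {suc i} λ ()))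
    others (suc j) j≢i = cong 𝟙 (<⇒<ᵇ≡true (<-≤-trans (s≤s (dist-leaf-centre≤1 j))
                                                       (dist-between-leaves≥2 (j≢i ∘ cong suc))))

  nClose-leaf≥1 : ∀ i → 1 ≤ nClose (star m) (suc i) zero
  nClose-leaf≥1 i = begin
    1                                                          ≡⟨ cong 𝟙 (<⇒<ᵇ≡true (≢⇒dist>0 {suc i} {zero} λ ())) ⟨
    𝟙 (0 <ᵇ dist (star m) (suc i) zero)                        ≡⟨ cong (λ d → 𝟙 (d <ᵇ dist (star m) (suc i) zero)) (dist-self (suc i)) ⟨
    𝟙 (dist (star m) (suc i) (suc i) <ᵇ dist (star m) (suc i) zero)
                                                               ≤⟨ term≤sum (λ x → 𝟙 (dist (star m) x (suc i) <ᵇ dist (star m) x zero)) (suc i) ⟩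
    ∑[ x < suc m ] 𝟙 (dist (star m) x (suc i) <ᵇ dist (star m) x zero)
                                                               ≡⟨ nClose≡∑ (suc i) zero ⟨
    nClose (star m) (suc i) zero                               ∎
    where open ≤-Reasoning

  wSz-star≥ : suc m * (m * m) ≤ wSz (star m)
  wSz-star≥ = begin
    suc m * (m * m)                                  ≡⟨ rearrange m ⟩
    m * ((m + 1) * m * 1)                            ≡⟨ sum-const m _ ⟨
    ∑[ i < m ] ((m + 1) * m * 1)                     ≤⟨ sum-mono-≤ leaf-edge ⟩
    ∑[ i < m ] edgeTerm (star m) zero (suc i)        ≤⟨ m≤n+m _ (edgeTerm (star m) zero zero) ⟩
    ∑[ v < suc m ] edgeTerm (star m) zero v          ≤⟨ term≤sum (λ u → ∑[ v < suc m ] edgeTerm (star m) u v) zero ⟩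
    ∑[ u < suc m ] ∑[ v < suc m ] edgeTerm (star m) u v
                                                     ≡⟨ wSz≡∑∑edgeTerm ⟨
    wSz (star m)                                     ∎
    where
    open ≤-Reasoning
    rearrange : ∀ m → suc m * (m * m) ≡ m * ((m + 1) * m * 1)
    rearrange = solve-∀
    leaf-edge : ∀ i → (m + 1) * m * 1 ≤ edgeTerm (star m) zero (suc i)
    leaf-edge i = *-mono-≤ (*-mono-≤ (≤-reflexive (sym (cong₂ _+_ deg-centre (deg-leaf i))))
                                     (≤-reflexive (sym (nClose-centre i))))
                           (nClose-leaf≥1 i)

theorem1 : ∀ (m : ℕ) (T : Graph (suc m)) → IsTree T → wSz T ≤ wSz (star m)
theorem1 m T (connected , acyclic) = begin
  wSz T            ≤⟨ TreeBound.wSz-≤ T connected acyclic ⟩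
  suc m * (m * m)  ≤⟨ StarIndex.wSz-star≥ m ⟩
  wSz (star m)     ∎
  where open ≤-Reasoning
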